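{- Let $p\ge 2$ be an integer and let $\frac{a}{p},\frac{b}{p}$ be irreducible fractions with $ab\equiv 1\pmod p$. Then $\mathcal{S}_{\frac{a}{p}}(q)=\mathcal{S}^\vee_{\frac{b}{p}}(q)$.
   Context: For an integer $c$, $[c]_q=\frac{1-q^c}{1-q}$. Every rational $\alpha>1$ has a unique negative continued fraction expansion $\alpha=c_1-\cfrac{1}{c_2-\cfrac{1}{\ddots-\cfrac{1}{c_l}}}$ with integers $c_j\ge 2$. Put $M^-_q(c)=\begin{pmatrix}[c]_q & -q^{c-1}\\ 1 & 0\end{pmatrix}$ and define $\mathcal{R}_\alpha(q),\mathcal{S}_\alpha(q)$ by $\begin{pmatrix}\mathcal{R}_\alpha(q)\\ \mathcal{S}_\alpha(q)\end{pmatrix}=M^-_q(c_1)\cdots M^-_q(c_l)\begin{pmatrix}1\\0\end{pmatrix}$. For rational $\alpha\le 1$ these are defined recursively by $\mathcal{S}_\alpha(q)=\mathcal{S}_{\alpha+1}(q)$ and $\mathcal{R}_\alpha(q)=q^{ -1}(\mathcal{R}_{\alpha+1}(q)-\mathcal{S}_{\alpha+1}(q))$. For every rational $\alpha$, $\mathcal{S}_\alpha(q)\in\mathbb Z[q]$. For a nonzero polynomial $f(q)$, $f^\vee(q)=q^{\deg f}f(q^{ -1})$. An irreducible fraction $\frac{r}{s}$ means $\gcd(r,s)=1$, $s>0$. -}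

module Defs where

open import Data.Nat as ℕ using (ℕ; zero; suc)
open import Data.Nat.DivMod using (_/_)
open import Data.Integer as ℤ using (ℤ; +_; 0ℤ; 1ℤ; -1ℤ)
open import Data.List using (List; []; _∷_; replicate; reverse; _++_; foldr; [_])
open import Data.Product using (_×_; _,_; proj₁; proj₂)
open import Data.Bool using (if_then_else_)
open import Relation.Nullary.Decidable using (does)
open import Relation.Binary.PropositionalEquality using (_≡_)

-- Integer polynomials ℤ[q] as coefficient lists (constant term first).
-- Trailing zero coefficients are allowed; `norm` strips them.

Poly : Set
Poly = List ℤ

_⊕_ : Poly → Poly → Poly
[] ⊕ g = g
(x ∷ f) ⊕ [] = x ∷ f
(x ∷ f) ⊕ (y ∷ g) = (x ℤ.+ y) ∷ (f ⊕ g)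

scale : ℤ → Poly → Poly
scale c [] = []
scale c (x ∷ f) = (c ℤ.* x) ∷ scale c f

_⊗_ : Poly → Poly → Poly
[] ⊗ g = []
(x ∷ f) ⊗ g = scale x g ⊕ (0ℤ ∷ (f ⊗ g))

neg : Poly → Poly
neg = scale -1ℤ

qint : ℕ → Poly
qint c = replicate c 1ℤ

qpow : ℕ → Poly
qpow k = replicate k 0ℤ ++ [ 1ℤ ]

norm : Poly → Poly
norm = foldr step []
  where
  step : ℤ → Poly → Poly
  step x [] = if does (x ℤ.≟ 0ℤ) then [] else [ x ]
  step x (y ∷ ys) = x ∷ y ∷ ys

-- f^∨(q) = q^(deg f) f(q^{-1}) : reverse the coefficients of the normalised polynomial
dual : Poly → Poly
dual f = reverse (norm f)

-- M^-_q(c) applied to a column vector (x , y):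
--   M^-_q(c) (x , y)ᵀ = ([c]_q x - q^(c-1) y , x)ᵀ

Mq : ℕ → Poly × Poly → Poly × Poly
Mq c (x , y) = ((qint c ⊗ x) ⊕ neg (qpow (c ℕ.∸ 1) ⊗ y)) , x

-- Negative continued fraction of r/s > 1 (r, s natural, s ≥ 1):
--   c₁ = ⌈r/s⌉ ; if c₁ = r/s the expansion ends, otherwise
--   r/s = c₁ - 1/(s/(c₁ s - r)) with s/(c₁ s - r) > 1.
-- `cfVec fuel r s` computes M^-_q(c₁) ⋯ M^-_q(c_l) (1 , 0)ᵀ = (R , S).
-- The denominator strictly decreases, so fuel s suffices;
-- the fuel-exhausted / s = 0 branches are never reached for inputs used below.

cfVec : ℕ → ℕ → ℕ → Poly × Poly
cfVec zero r s = [] , []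
cfVec (suc fuel) r zero = [] , []
cfVec (suc fuel) r (suc s') with (suc s' ℕ.* ((r ℕ.+ s') / suc s')) ℕ.∸ r
... | zero  = Mq ((r ℕ.+ s') / suc s') ([ 1ℤ ] , [])
... | suc d = Mq ((r ℕ.+ s') / suc s') (cfVec fuel (suc s') (suc d))

-- S_{a/p}(q) for an integer a and a natural p ≥ 1.
-- If a/p > 1, S is the second component of cfVec; otherwise
-- S_α = S_{α+1}, i.e. S_{a/p} = S_{(a+p)/p}.  Fuel ∣a∣ + 2 suffices.

Sfuel : ℕ → ℤ → ℕ → Poly
Sfuel zero a p = []
Sfuel (suc fuel) a p with does ((+ p) ℤ.<? a)
... | Data.Bool.true  = proj₂ (cfVec (suc p) ℤ.∣ a ∣ p)
... | Data.Bool.false = Sfuel fuel (a ℤ.+ + p) p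

qS : ℤ → ℕ → Poly
qS a p = Sfuel (suc (suc ℤ.∣ a ∣)) a p

_≈P_ : Poly → Poly → Set
f ≈P g = norm f ≡ norm g

-- Reduce a and b modulo p: with 0 < u, v < p, u ≡ -a and v ≡ -b, one has 𝒮_{a/p} = ℛ_{p/u},
-- 𝒮_{b/p} = ℛ_{p/v} and u v ≡ 1 (mod p). At q = 1 the digit matrices of the negative
-- continued fraction of p/u multiply to a matrix with first column (p, u) and determinant 1;
-- reversing the digits transposes that product up to signs, so the reversed digits expand
-- p/u' with u' u ≡ 1, i.e. u' = v. Finally the continuant ℛ of the reversed digits is ℛ with
-- its coefficient list reversed, and since ℛ has constant term 1 this is exactly its dual.

module Submission where

open import Defs
open import Data.Nat using (ℕ; _≤_)
open import Data.Integer using (ℤ; +_; _*_; _-_; 1ℤ)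
open import Data.Integer.Divisibility using (_∣_)
open import Data.Integer.Coprimality using (Coprime)

open import Algebra.Bundles using (CommutativeSemigroup)
open import Data.Bool using (if_then_else_)
open import Data.Integer using (_+_; -_; ∣_∣; 0ℤ; -1ℤ; -[1+_])
import Data.Integer as ℤ
import Data.Integer.Properties as ℤ
import Data.Integer.Divisibility.Signed as Signed
open Signed using () renaming (_∣_ to _∣ₛ_)
open import Data.Integer.Tactic.RingSolver using (solve-∀)
open import Data.List using (List; []; _∷_; _++_; replicate; reverse; length; [_]; map)
import Data.List.Properties as List
open import Data.List.Relation.Unary.All using (All; []; _∷_)
import Data.List.Relation.Unary.All as All
import Data.List.Relation.Unary.All.Properties as All
open import Data.Nat as ℕ using (zero; suc; _∸_; _<_; s≤s; z≤n)
import Data.Nat.Properties as ℕ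
open import Data.Nat.DivMod using (_/_; _%_; m%n<n; m≡m%n+[m/n]*n; /-congˡ; +-distrib-/-∣ʳ; m<n⇒m/n≡0; m*n/n≡m)
open import Data.Nat.Divisibility using (divides; n∣m*n; ∣m⇒∣m*n; ∣m+n∣m⇒∣n; ∣1⇒≡1; ∣⇒≤)
  renaming (_∣_ to _∣ℕ_; ∣-refl to ∣ℕ-refl)
open import Data.Product using (_×_; _,_; proj₁; proj₂; Σ-syntax)
open import Data.Sum using (_⊎_; inj₁; inj₂)
open import Function using (_∘_)
open import Relation.Binary.PropositionalEquality hiding ([_]; J)
open import Relation.Nullary using (¬_; contradiction; yes; no)
open import Relation.Nullary.Decidable using (does)
open ≡-Reasoning

-- Polynomial arithmetic on coefficient lists

⊕-comm : ∀ f g → f ⊕ g ≡ g ⊕ f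
⊕-comm []      []      = refl
⊕-comm []      (y ∷ g) = refl
⊕-comm (x ∷ f) []      = refl
⊕-comm (x ∷ f) (y ∷ g) = cong₂ _∷_ (ℤ.+-comm x y) (⊕-comm f g)

⊕-assoc : ∀ f g h → (f ⊕ g) ⊕ h ≡ f ⊕ (g ⊕ h)
⊕-assoc []      g       h       = refl
⊕-assoc (x ∷ f) []      h       = refl
⊕-assoc (x ∷ f) (y ∷ g) []      = refl
⊕-assoc (x ∷ f) (y ∷ g) (z ∷ h) = cong₂ _∷_ (ℤ.+-assoc x y z) (⊕-assoc f g h)

⊕-commutativeSemigroup : CommutativeSemigroup _ _
⊕-commutativeSemigroup = record
  { Carrier = Poly ; _≈_ = _≡_ ; _∙_ = _⊕_
  ; isCommutativeSemigroup = record
    { isSemigroup = record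
      { isMagma = record { isEquivalence = isEquivalence ; ∙-cong = cong₂ _⊕_ }
      ; assoc = ⊕-assoc }
    ; comm = ⊕-comm } }

open import Algebra.Properties.CommutativeSemigroup ⊕-commutativeSemigroup
  using () renaming (interchange to ⊕-interchange; x∙yz≈y∙xz to ⊕-leftComm)

zeros : ℕ → Poly
zeros k = replicate k 0ℤ

shift : ℕ → Poly → Poly
shift k f = zeros k ++ f

pad : ℕ → Poly → Poly
pad k f = f ++ zeros k

zeros-⊕ : ∀ k h → k ≤ length h → zeros k ⊕ h ≡ h
zeros-⊕ zero    h       _       = refl
zeros-⊕ (suc k) (y ∷ h) (s≤s k≤h) = cong₂ _∷_ (ℤ.+-identityˡ y) (zeros-⊕ k h k≤h)

⊕-zeros : ∀ k h → k ≤ length h → h ⊕ zeros k ≡ h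
⊕-zeros k h k≤h = trans (⊕-comm h (zeros k)) (zeros-⊕ k h k≤h)

zeros-++ : ∀ a b → zeros a ++ zeros b ≡ zeros (a ℕ.+ b)
zeros-++ zero    b = refl
zeros-++ (suc a) b = cong (0ℤ ∷_) (zeros-++ a b)

zeros-∷ʳ : ∀ k → zeros k ++ [ 0ℤ ] ≡ zeros (suc k)
zeros-∷ʳ zero    = refl
zeros-∷ʳ (suc k) = cong (0ℤ ∷_) (zeros-∷ʳ k)

shift-⊕ : ∀ k f g → shift k (f ⊕ g) ≡ shift k f ⊕ shift k g
shift-⊕ zero    f g = refl
shift-⊕ (suc k) f g = cong (0ℤ ∷_) (shift-⊕ k f g)

shift-shift : ∀ a b f → shift a (shift b f) ≡ shift (a ℕ.+ b) f
shift-shift a b f = trans (sym (List.++-assoc (zeros a) (zeros b) f)) (cong (_++ f) (zeros-++ a b))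

shift-comm : ∀ a b f → shift a (shift b f) ≡ shift b (shift a f)
shift-comm a b f = begin
  shift a (shift b f) ≡⟨ shift-shift a b f ⟩
  shift (a ℕ.+ b) f   ≡⟨ cong (λ n → shift n f) (ℕ.+-comm a b) ⟩
  shift (b ℕ.+ a) f   ≡⟨ shift-shift b a f ⟨
  shift b (shift a f) ∎

length-pad : ∀ k f → length (pad k f) ≡ length f ℕ.+ k
length-pad k f = trans (List.length-++ f) (cong (length f ℕ.+_) (List.length-replicate k))

length-shift : ∀ k f → length (shift k f) ≡ k ℕ.+ length f
length-shift k f = trans (List.length-++ (zeros k)) (cong (ℕ._+ length f) (List.length-replicate k))

k≤length-pad : ∀ k f → k ≤ length (pad k f)
k≤length-pad k f = ℕ.≤-trans (ℕ.m≤n+m k (length f)) (ℕ.≤-reflexive (sym (length-pad k f)))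

pad-⊕ : ∀ k f g → pad k (f ⊕ g) ≡ pad k f ⊕ pad k g
pad-⊕ k []      g       = sym (zeros-⊕ k (pad k g) (k≤length-pad k g))
pad-⊕ k (x ∷ f) []      = sym (⊕-zeros k (pad k (x ∷ f)) (k≤length-pad k (x ∷ f)))
pad-⊕ k (x ∷ f) (y ∷ g) = cong ((x + y) ∷_) (pad-⊕ k f g)

pad-pad : ∀ a b f → pad a (pad b f) ≡ pad (a ℕ.+ b) f
pad-pad a b f = trans (List.++-assoc f (zeros b) (zeros a)) (cong (f ++_) (trans (zeros-++ b a) (cong zeros (ℕ.+-comm b a))))

pad-comm : ∀ a b f → pad a (pad b f) ≡ pad b (pad a f)
pad-comm a b f = begin
  pad a (pad b f) ≡⟨ pad-pad a b f ⟩
  pad (a ℕ.+ b) f ≡⟨ cong (λ n → pad n f) (ℕ.+-comm a b) ⟩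
  pad (b ℕ.+ a) f ≡⟨ pad-pad b a f ⟨
  pad b (pad a f) ∎

shift-pad : ∀ a b f → shift a (pad b f) ≡ pad b (shift a f)
shift-pad a b f = sym (List.++-assoc (zeros a) f (zeros b))

scale-⊕ : ∀ c f g → scale c (f ⊕ g) ≡ scale c f ⊕ scale c g
scale-⊕ c []      g       = refl
scale-⊕ c (x ∷ f) []      = refl
scale-⊕ c (x ∷ f) (y ∷ g) = cong₂ _∷_ (ℤ.*-distribˡ-+ c x y) (scale-⊕ c f g)

scale-++ : ∀ c f g → scale c (f ++ g) ≡ scale c f ++ scale c g
scale-++ c []      g = refl
scale-++ c (x ∷ f) g = cong (c * x ∷_) (scale-++ c f g)

scale-zeros : ∀ c k → scale c (zeros k) ≡ zeros k
scale-zeros c zero    = refl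
scale-zeros c (suc k) = cong₂ _∷_ (ℤ.*-zeroʳ c) (scale-zeros c k)

scale≡map : ∀ c f → scale c f ≡ map (c *_) f
scale≡map c []      = refl
scale≡map c (x ∷ f) = cong (c * x ∷_) (scale≡map c f)

length-scale : ∀ c f → length (scale c f) ≡ length f
length-scale c f = trans (cong length (scale≡map c f)) (List.length-map (c *_) f)

neg-⊕ : ∀ f g → neg (f ⊕ g) ≡ neg f ⊕ neg g
neg-⊕ = scale-⊕ -1ℤ

neg-zeros : ∀ k → neg (zeros k) ≡ zeros k
neg-zeros = scale-zeros -1ℤ

neg-shift : ∀ k f → neg (shift k f) ≡ shift k (neg f)
neg-shift k f = trans (scale-++ -1ℤ (zeros k) f) (cong (_++ neg f) (neg-zeros k))

neg-pad : ∀ k f → neg (pad k f) ≡ pad k (neg f)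
neg-pad k f = trans (scale-++ -1ℤ f (zeros k)) (cong (neg f ++_) (neg-zeros k))

neg-involutive : ∀ f → neg (neg f) ≡ f
neg-involutive []      = refl
neg-involutive (x ∷ f) = cong₂ _∷_ (trans (sym (ℤ.*-assoc -1ℤ -1ℤ x)) (ℤ.*-identityˡ x)) (neg-involutive f)

-- f + q f + ⋯ + q ^ k f, padded so that its length is exactly k + length f
qsum : ℕ → Poly → Poly
qsum zero    f = f
qsum (suc k) f = pad (suc k) f ⊕ shift 1 (qsum k f)

qsum-⊕ : ∀ k f g → qsum k (f ⊕ g) ≡ qsum k f ⊕ qsum k g
qsum-⊕ zero    f g = refl
qsum-⊕ (suc k) f g = begin
  pad (suc k) (f ⊕ g) ⊕ shift 1 (qsum k (f ⊕ g))
    ≡⟨ cong₂ _⊕_ (pad-⊕ (suc k) f g) (trans (cong (shift 1) (qsum-⊕ k f g)) (shift-⊕ 1 (qsum k f) (qsum k g))) ⟩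
  (pad (suc k) f ⊕ pad (suc k) g) ⊕ (shift 1 (qsum k f) ⊕ shift 1 (qsum k g))
    ≡⟨ ⊕-interchange (pad (suc k) f) (pad (suc k) g) (shift 1 (qsum k f)) (shift 1 (qsum k g)) ⟩
  qsum (suc k) f ⊕ qsum (suc k) g ∎

qsum-neg : ∀ k f → qsum k (neg f) ≡ neg (qsum k f)
qsum-neg zero    f = refl
qsum-neg (suc k) f = begin
  pad (suc k) (neg f) ⊕ shift 1 (qsum k (neg f))
    ≡⟨ cong₂ _⊕_ (sym (neg-pad (suc k) f)) (trans (cong (shift 1) (qsum-neg k f)) (sym (neg-shift 1 (qsum k f)))) ⟩
  neg (pad (suc k) f) ⊕ neg (shift 1 (qsum k f))
    ≡⟨ neg-⊕ (pad (suc k) f) (shift 1 (qsum k f)) ⟨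
  neg (qsum (suc k) f) ∎

qsum-shift : ∀ k j f → qsum k (shift j f) ≡ shift j (qsum k f)
qsum-shift zero    j f = refl
qsum-shift (suc k) j f = begin
  pad (suc k) (shift j f) ⊕ shift 1 (qsum k (shift j f))
    ≡⟨ cong₂ _⊕_ (sym (shift-pad j (suc k) f)) (trans (cong (shift 1) (qsum-shift k j f)) (shift-comm 1 j (qsum k f))) ⟩
  shift j (pad (suc k) f) ⊕ shift j (shift 1 (qsum k f))
    ≡⟨ shift-⊕ j (pad (suc k) f) (shift 1 (qsum k f)) ⟨
  shift j (qsum (suc k) f) ∎

qsum-pad : ∀ k j f → qsum k (pad j f) ≡ pad j (qsum k f)
qsum-pad zero    j f = refl
qsum-pad (suc k) j f = begin
  pad (suc k) (pad j f) ⊕ shift 1 (qsum k (pad j f))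
    ≡⟨ cong₂ _⊕_ (pad-comm (suc k) j f) (trans (cong (shift 1) (qsum-pad k j f)) (shift-pad 1 j (qsum k f))) ⟩
  pad j (pad (suc k) f) ⊕ pad j (shift 1 (qsum k f))
    ≡⟨ pad-⊕ j (pad (suc k) f) (shift 1 (qsum k f)) ⟨
  pad j (qsum (suc k) f) ∎

qsum-comm : ∀ a b f → qsum a (qsum b f) ≡ qsum b (qsum a f)
qsum-comm zero    b f = refl
qsum-comm (suc a) b f = begin
  pad (suc a) (qsum b f) ⊕ shift 1 (qsum a (qsum b f))
    ≡⟨ cong₂ _⊕_ (sym (qsum-pad b (suc a) f)) (trans (cong (shift 1) (qsum-comm a b f)) (sym (qsum-shift b 1 (qsum a f)))) ⟩
  qsum b (pad (suc a) f) ⊕ qsum b (shift 1 (qsum a f))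
    ≡⟨ qsum-⊕ b (pad (suc a) f) (shift 1 (qsum a f)) ⟨
  qsum b (qsum (suc a) f) ∎

qsum-sucʳ : ∀ k f → qsum (suc k) f ≡ shift (suc k) f ⊕ pad 1 (qsum k f)
qsum-sucʳ zero    f = ⊕-comm (pad 1 f) (shift 1 f)
qsum-sucʳ (suc k) f = begin
  pad (2 ℕ.+ k) f ⊕ shift 1 (qsum (suc k) f)
    ≡⟨ cong (λ z → pad (2 ℕ.+ k) f ⊕ shift 1 z) (qsum-sucʳ k f) ⟩
  pad (2 ℕ.+ k) f ⊕ shift 1 (shift (suc k) f ⊕ pad 1 (qsum k f))
    ≡⟨ cong (pad (2 ℕ.+ k) f ⊕_) (shift-⊕ 1 (shift (suc k) f) (pad 1 (qsum k f))) ⟩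
  pad (2 ℕ.+ k) f ⊕ (shift (2 ℕ.+ k) f ⊕ shift 1 (pad 1 (qsum k f)))
    ≡⟨ ⊕-leftComm (pad (2 ℕ.+ k) f) (shift (2 ℕ.+ k) f) (shift 1 (pad 1 (qsum k f))) ⟩
  shift (2 ℕ.+ k) f ⊕ (pad (2 ℕ.+ k) f ⊕ shift 1 (pad 1 (qsum k f)))
    ≡⟨ cong₂ (λ u v → shift (2 ℕ.+ k) f ⊕ (u ⊕ v)) (sym (pad-pad 1 (suc k) f)) (shift-pad 1 1 (qsum k f)) ⟩
  shift (2 ℕ.+ k) f ⊕ (pad 1 (pad (suc k) f) ⊕ pad 1 (shift 1 (qsum k f)))
    ≡⟨ cong (shift (2 ℕ.+ k) f ⊕_) (pad-⊕ 1 (pad (suc k) f) (shift 1 (qsum k f))) ⟨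
  shift (2 ℕ.+ k) f ⊕ pad 1 (qsum (suc k) f) ∎

length-⊕ : ∀ f g → length (f ⊕ g) ≡ length f ℕ.⊔ length g
length-⊕ []      g       = refl
length-⊕ (x ∷ f) []      = refl
length-⊕ (x ∷ f) (y ∷ g) = cong suc (length-⊕ f g)

length-⊕-≡ : ∀ f g → length f ≡ length g → length (f ⊕ g) ≡ length f
length-⊕-≡ f g eq = trans (length-⊕ f g) (trans (cong (length f ℕ.⊔_) (sym eq)) (ℕ.⊔-idem (length f)))

length-qsum-summands : ∀ k f → length (pad (suc k) f) ≡ length (shift 1 (qsum k f))

length-qsum : ∀ k f → length (qsum k f) ≡ k ℕ.+ length f
length-qsum zero    f = refl
length-qsum (suc k) f =
  trans (length-⊕-≡ (pad (suc k) f) (shift 1 (qsum k f)) (length-qsum-summands k f))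
        (trans (length-pad (suc k) f) (ℕ.+-comm (length f) (suc k)))

length-qsum-summands k f = trans (length-pad (suc k) f)
  (trans (ℕ.+-comm (length f) (suc k)) (cong suc (sym (length-qsum k f))))

∷ʳ-⊕ : ∀ f g x y → length f ≡ length g → (f ++ [ x ]) ⊕ (g ++ [ y ]) ≡ (f ⊕ g) ++ [ x + y ]
∷ʳ-⊕ []      []      x y eq = refl
∷ʳ-⊕ (a ∷ f) (b ∷ g) x y eq = cong ((a + b) ∷_) (∷ʳ-⊕ f g x y (ℕ.suc-injective eq))

reverse-⊕ : ∀ f g → length f ≡ length g → reverse (f ⊕ g) ≡ reverse f ⊕ reverse g
reverse-⊕ []      []      eq = refl
reverse-⊕ (x ∷ f) (y ∷ g) eq = begin
  reverse ((x + y) ∷ (f ⊕ g))            ≡⟨ List.unfold-reverse (x + y) (f ⊕ g) ⟩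
  reverse (f ⊕ g) ++ [ x + y ]           ≡⟨ cong (_++ [ x + y ]) (reverse-⊕ f g f≡g) ⟩
  (reverse f ⊕ reverse g) ++ [ x + y ]   ≡⟨ ∷ʳ-⊕ (reverse f) (reverse g) x y rf≡rg ⟨
  (reverse f ++ [ x ]) ⊕ (reverse g ++ [ y ])
    ≡⟨ cong₂ _⊕_ (List.unfold-reverse x f) (List.unfold-reverse y g) ⟨
  reverse (x ∷ f) ⊕ reverse (y ∷ g)      ∎
  where
  f≡g = ℕ.suc-injective eq
  rf≡rg = trans (List.length-reverse f) (trans f≡g (sym (List.length-reverse g)))

reverse-neg : ∀ f → reverse (neg f) ≡ neg (reverse f)
reverse-neg f = begin
  reverse (neg f)            ≡⟨ cong reverse (scale≡map -1ℤ f) ⟩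
  reverse (map (-1ℤ *_) f)   ≡⟨ List.reverse-map (-1ℤ *_) f ⟨
  map (-1ℤ *_) (reverse f)   ≡⟨ scale≡map -1ℤ (reverse f) ⟨
  neg (reverse f)            ∎

reverse-zeros : ∀ k → reverse (zeros k) ≡ zeros k
reverse-zeros zero    = refl
reverse-zeros (suc k) = trans (List.unfold-reverse 0ℤ (zeros k))
  (trans (cong (_++ [ 0ℤ ]) (reverse-zeros k)) (zeros-∷ʳ k))

reverse-shift : ∀ k f → reverse (shift k f) ≡ pad k (reverse f)
reverse-shift k f = trans (List.reverse-++ (zeros k) f) (cong (reverse f ++_) (reverse-zeros k))

reverse-pad : ∀ k f → reverse (pad k f) ≡ shift k (reverse f)
reverse-pad k f = trans (List.reverse-++ f (zeros k)) (cong (_++ reverse f) (reverse-zeros k))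

reverse-qsum : ∀ k f → reverse (qsum k f) ≡ qsum k (reverse f)
reverse-qsum zero    f = refl
reverse-qsum (suc k) f = begin
  reverse (pad (suc k) f ⊕ shift 1 (qsum k f))
    ≡⟨ reverse-⊕ (pad (suc k) f) (shift 1 (qsum k f)) (length-qsum-summands k f) ⟩
  reverse (pad (suc k) f) ⊕ reverse (shift 1 (qsum k f))
    ≡⟨ cong₂ _⊕_ (reverse-pad (suc k) f) (trans (reverse-shift 1 (qsum k f)) (cong (pad 1) (reverse-qsum k f))) ⟩
  shift (suc k) (reverse f) ⊕ pad 1 (qsum k (reverse f))
    ≡⟨ qsum-sucʳ k (reverse f) ⟨
  qsum (suc k) (reverse f) ∎

-- Reversal symmetry of continuants

-- M⁻_q(c) acting on a pair, with both entries padded to a common length (so that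
-- reversing coefficient lists commutes with the step); the padding is harmless since
-- polynomials are only compared up to trailing zeros.
padStep : ℕ → Poly × Poly → Poly × Poly
padStep c (x , t) = (qsum (c ∸ 1) x ⊕ neg (shift (c ∸ 1) t)) , pad (c ∸ 1) x

padVec : List ℕ → Poly × Poly
padVec []       = [ 1ℤ ] , [ 0ℤ ]
padVec (c ∷ cs) = padStep c (padVec cs)

𝓡 : List ℕ → Poly
𝓡 cs = proj₁ (padVec cs)

padVec-balanced : ∀ cs → length (proj₁ (padVec cs)) ≡ length (proj₂ (padVec cs))

length-padStep-summands : ∀ c cs →
  length (qsum (c ∸ 1) (𝓡 cs)) ≡ length (neg (shift (c ∸ 1) (proj₂ (padVec cs))))
length-padStep-summands c cs = begin
  length (qsum k x)        ≡⟨ length-qsum k x ⟩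
  k ℕ.+ length x           ≡⟨ cong (k ℕ.+_) (padVec-balanced cs) ⟩
  k ℕ.+ length t           ≡⟨ length-shift k t ⟨
  length (shift k t)       ≡⟨ length-scale -1ℤ (shift k t) ⟨
  length (neg (shift k t)) ∎
  where
  k = c ∸ 1
  x = 𝓡 cs
  t = proj₂ (padVec cs)

padVec-balanced []       = refl
padVec-balanced (c ∷ cs) = begin
  length (qsum k x ⊕ neg (shift k t)) ≡⟨ length-⊕-≡ (qsum k x) (neg (shift k t)) (length-padStep-summands c cs) ⟩
  length (qsum k x)                   ≡⟨ length-qsum k x ⟩
  k ℕ.+ length x                      ≡⟨ ℕ.+-comm k (length x) ⟩
  length x ℕ.+ k                      ≡⟨ length-pad k x ⟨
  length (pad k x)                    ∎
  where
  k = c ∸ 1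
  x = 𝓡 cs
  t = proj₂ (padVec cs)

-- The recursion of continuants at the right end of the digit list (see padVec-++).
rightComb : ℕ → ℕ → Poly → Poly → Poly
rightComb c d u v = qsum (c ∸ 1) u ⊕ neg (pad (c ∸ 1) (shift (d ∸ 1) v))

rightStep : ℕ → ℕ → Poly × Poly → Poly × Poly → Poly × Poly
rightStep c d (u₁ , u₂) (v₁ , v₂) = rightComb c d u₁ v₁ , rightComb c d u₂ v₂

padStep-rightStep : ∀ x c d U V → padStep x (rightStep c d U V) ≡ rightStep c d (padStep x U) (padStep x V)
padStep-rightStep x c d (u₁ , u₂) (v₁ , v₂) = cong₂ _,_ first second
  where
  X = x ∸ 1
  K = c ∸ 1
  J = d ∸ 1
  a₁ = qsum X (qsum K u₁)
  a₂ = qsum X (neg (pad K (shift J v₁)))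
  a₃ = neg (shift X (qsum K u₂))
  a₄ = neg (shift X (neg (pad K (shift J v₂))))
  b₁ = qsum K (qsum X u₁)
  b₂ = neg (pad K (shift J (qsum X v₁)))
  b₃ = qsum K (neg (shift X u₂))
  b₄ = neg (pad K (shift J (neg (shift X v₂))))
  a₁≡b₁ : a₁ ≡ b₁
  a₁≡b₁ = qsum-comm X K u₁
  a₂≡b₂ : a₂ ≡ b₂
  a₂≡b₂ = trans (qsum-neg X (pad K (shift J v₁)))
                (cong neg (trans (qsum-pad X K (shift J v₁)) (cong (pad K) (qsum-shift X J v₁))))
  a₃≡b₃ : a₃ ≡ b₃
  a₃≡b₃ = sym (trans (qsum-neg K (shift X u₂)) (cong neg (qsum-shift K X u₂)))
  a₄≡b₄ : a₄ ≡ b₄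
  a₄≡b₄ = begin
    neg (shift X (neg (pad K (shift J v₂))))  ≡⟨ cong neg (neg-shift X (pad K (shift J v₂))) ⟨
    neg (neg (shift X (pad K (shift J v₂))))  ≡⟨ neg-involutive _ ⟩
    shift X (pad K (shift J v₂))              ≡⟨ shift-pad X K (shift J v₂) ⟩
    pad K (shift X (shift J v₂))              ≡⟨ cong (pad K) (shift-comm X J v₂) ⟩
    pad K (shift J (shift X v₂))              ≡⟨ neg-involutive _ ⟨
    neg (neg (pad K (shift J (shift X v₂))))
      ≡⟨ cong neg (trans (neg-pad K (shift J (shift X v₂))) (cong (pad K) (neg-shift J (shift X v₂)))) ⟩
    neg (pad K (shift J (neg (shift X v₂))))  ∎
  first : proj₁ (padStep x (rightStep c d (u₁ , u₂) (v₁ , v₂)))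
        ≡ proj₁ (rightStep c d (padStep x (u₁ , u₂)) (padStep x (v₁ , v₂)))
  first = begin
    qsum X (qsum K u₁ ⊕ neg (pad K (shift J v₁))) ⊕ neg (shift X (qsum K u₂ ⊕ neg (pad K (shift J v₂))))
      ≡⟨ cong₂ _⊕_ (qsum-⊕ X (qsum K u₁) (neg (pad K (shift J v₁))))
                   (trans (cong neg (shift-⊕ X (qsum K u₂) (neg (pad K (shift J v₂)))))
                          (neg-⊕ (shift X (qsum K u₂)) (shift X (neg (pad K (shift J v₂)))))) ⟩
    (a₁ ⊕ a₂) ⊕ (a₃ ⊕ a₄) ≡⟨ ⊕-interchange a₁ a₂ a₃ a₄ ⟩
    (a₁ ⊕ a₃) ⊕ (a₂ ⊕ a₄) ≡⟨ cong₂ _⊕_ (cong₂ _⊕_ a₁≡b₁ a₃≡b₃) (cong₂ _⊕_ a₂≡b₂ a₄≡b₄) ⟩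
    (b₁ ⊕ b₃) ⊕ (b₂ ⊕ b₄)
      ≡⟨ cong₂ _⊕_ (qsum-⊕ K (qsum X u₁) (neg (shift X u₂)))
                   (trans (cong (λ z → neg (pad K z)) (shift-⊕ J (qsum X v₁) (neg (shift X v₂))))
                     (trans (cong neg (pad-⊕ K (shift J (qsum X v₁)) (shift J (neg (shift X v₂)))))
                       (neg-⊕ (pad K (shift J (qsum X v₁))) (pad K (shift J (neg (shift X v₂))))))) ⟨
    qsum K (qsum X u₁ ⊕ neg (shift X u₂)) ⊕ neg (pad K (shift J (qsum X v₁ ⊕ neg (shift X v₂)))) ∎
  second : pad X (rightComb c d u₁ v₁) ≡ rightComb c d (pad X u₁) (pad X v₁)
  second = begin
    pad X (qsum K u₁ ⊕ neg (pad K (shift J v₁)))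
      ≡⟨ pad-⊕ X (qsum K u₁) (neg (pad K (shift J v₁))) ⟩
    pad X (qsum K u₁) ⊕ pad X (neg (pad K (shift J v₁)))
      ≡⟨ cong₂ _⊕_ (sym (qsum-pad K X u₁))
           (trans (sym (neg-pad X (pad K (shift J v₁))))
                  (cong neg (trans (pad-comm X K (shift J v₁)) (cong (pad K) (sym (shift-pad J X v₁)))))) ⟩
    qsum K (pad X u₁) ⊕ neg (pad K (shift J (pad X v₁))) ∎

𝓡-singleton : ∀ c → 𝓡 [ c ] ≡ qsum (c ∸ 1) [ 1ℤ ]
𝓡-singleton c = begin
  qsum k [ 1ℤ ] ⊕ neg (shift k [ 0ℤ ])   ≡⟨ cong (λ z → qsum k [ 1ℤ ] ⊕ neg z) (zeros-∷ʳ k) ⟩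
  qsum k [ 1ℤ ] ⊕ neg (zeros (suc k))    ≡⟨ cong (qsum k [ 1ℤ ] ⊕_) (neg-zeros (suc k)) ⟩
  qsum k [ 1ℤ ] ⊕ zeros (suc k)          ≡⟨ ⊕-zeros (suc k) (qsum k [ 1ℤ ]) (ℕ.≤-reflexive (sym length-qsum-one)) ⟩
  qsum k [ 1ℤ ]                          ∎
  where
  k = c ∸ 1
  length-qsum-one : length (qsum k [ 1ℤ ]) ≡ suc k
  length-qsum-one = trans (length-qsum k [ 1ℤ ]) (ℕ.+-comm k 1)

padVec-++ : ∀ cs d c → padVec (cs ++ d ∷ c ∷ []) ≡ rightStep c d (padVec (cs ++ [ d ])) (padVec cs)
padVec-++ []       d c = cong₂ _,_ first second
  where
  kc = c ∸ 1
  kd = d ∸ 1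
  first : qsum kd (𝓡 [ c ]) ⊕ neg (shift kd (pad kc [ 1ℤ ]))
        ≡ qsum kc (𝓡 [ d ]) ⊕ neg (pad kc (shift kd [ 1ℤ ]))
  first = cong₂ _⊕_
    (begin
      qsum kd (𝓡 [ c ])          ≡⟨ cong (qsum kd) (𝓡-singleton c) ⟩
      qsum kd (qsum kc [ 1ℤ ])   ≡⟨ qsum-comm kd kc [ 1ℤ ] ⟩
      qsum kc (qsum kd [ 1ℤ ])   ≡⟨ cong (qsum kc) (𝓡-singleton d) ⟨
      qsum kc (𝓡 [ d ])          ∎)
    (cong neg (shift-pad kd kc [ 1ℤ ]))
  long-enough : suc kd ℕ.+ kc ≤ length (pad kd (qsum kc [ 1ℤ ]))
  long-enough = ℕ.≤-reflexive (sym (begin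
    length (pad kd (qsum kc [ 1ℤ ]))  ≡⟨ length-pad kd (qsum kc [ 1ℤ ]) ⟩
    length (qsum kc [ 1ℤ ]) ℕ.+ kd    ≡⟨ cong (ℕ._+ kd) (length-qsum kc [ 1ℤ ]) ⟩
    (kc ℕ.+ 1) ℕ.+ kd                  ≡⟨ cong (ℕ._+ kd) (ℕ.+-comm kc 1) ⟩
    suc kc ℕ.+ kd                      ≡⟨ cong suc (ℕ.+-comm kc kd) ⟩
    suc kd ℕ.+ kc                      ∎))
  second : pad kd (𝓡 [ c ]) ≡ qsum kc (pad kd [ 1ℤ ]) ⊕ neg (pad kc (shift kd [ 0ℤ ]))
  second = begin
    pad kd (𝓡 [ c ])                                 ≡⟨ cong (pad kd) (𝓡-singleton c) ⟩
    pad kd (qsum kc [ 1ℤ ])                          ≡⟨ ⊕-zeros (suc kd ℕ.+ kc) (pad kd (qsum kc [ 1ℤ ])) long-enough ⟨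
    pad kd (qsum kc [ 1ℤ ]) ⊕ zeros (suc kd ℕ.+ kc)
      ≡⟨ cong₂ _⊕_ (sym (qsum-pad kc kd [ 1ℤ ]))
           (sym (trans (cong (λ z → neg (pad kc z)) (zeros-∷ʳ kd))
                (trans (cong neg (zeros-++ (suc kd) kc)) (neg-zeros (suc kd ℕ.+ kc))))) ⟩
    qsum kc (pad kd [ 1ℤ ]) ⊕ neg (pad kc (shift kd [ 0ℤ ])) ∎
padVec-++ (x ∷ cs) d c = trans (cong (padStep x) (padVec-++ cs d c))
                               (padStep-rightStep x c d (padVec (cs ++ [ d ])) (padVec cs))

reverse-𝓡-step : ∀ c cs → reverse (𝓡 (c ∷ cs)) ≡ rightComb c 1 (reverse (𝓡 cs)) (reverse (proj₂ (padVec cs)))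
reverse-𝓡-step c cs = begin
  reverse (qsum k x ⊕ neg (shift k t))
    ≡⟨ reverse-⊕ (qsum k x) (neg (shift k t)) (length-padStep-summands c cs) ⟩
  reverse (qsum k x) ⊕ reverse (neg (shift k t))
    ≡⟨ cong₂ _⊕_ (reverse-qsum k x) (trans (reverse-neg (shift k t)) (cong neg (reverse-shift k t))) ⟩
  qsum k (reverse x) ⊕ neg (pad k (reverse t)) ∎
  where
  k = c ∸ 1
  x = 𝓡 cs
  t = proj₂ (padVec cs)

-- Both ends of the digit list obey the same recursion (padVec-++), so reversing the
-- digits turns the recursion from the left into the recursion from the right.
reverse-𝓡 : ∀ cs → reverse (𝓡 cs) ≡ 𝓡 (reverse cs)
reverse-𝓡 []            = refl
reverse-𝓡 (c ∷ [])      = trans (reverse-𝓡-step c [])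
  (cong (λ z → qsum (c ∸ 1) [ 1ℤ ] ⊕ neg z) (sym (zeros-∷ʳ (c ∸ 1))))
reverse-𝓡 (c ∷ c' ∷ cs) = begin
  reverse (𝓡 (c ∷ c' ∷ cs))                           ≡⟨ reverse-𝓡-step c (c' ∷ cs) ⟩
  rightComb c 1 (reverse (𝓡 (c' ∷ cs))) (reverse (pad (c' ∸ 1) (𝓡 cs)))
    ≡⟨ cong₂ (rightComb c 1) (trans (reverse-𝓡 (c' ∷ cs)) (cong 𝓡 (List.unfold-reverse c' cs)))
                              (trans (reverse-pad (c' ∸ 1) (𝓡 cs)) (cong (shift (c' ∸ 1)) (reverse-𝓡 cs))) ⟩
  rightComb c c' (𝓡 (reverse cs ++ [ c' ])) (𝓡 (reverse cs)) ≡⟨ cong proj₁ (padVec-++ (reverse cs) c' c) ⟨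
  𝓡 (reverse cs ++ c' ∷ c ∷ [])                        ≡⟨ cong 𝓡 reverse-digits ⟨
  𝓡 (reverse (c ∷ c' ∷ cs))                            ∎
  where
  reverse-digits : reverse (c ∷ c' ∷ cs) ≡ reverse cs ++ c' ∷ c ∷ []
  reverse-digits = trans (List.unfold-reverse c (c' ∷ cs))
    (trans (cong (_++ [ c ]) (List.unfold-reverse c' cs)) (List.++-assoc (reverse cs) [ c' ] [ c ]))

-- Coefficientwise equality and normalisation

coeff : Poly → ℕ → ℤ
coeff []      i       = 0ℤ
coeff (x ∷ f) zero    = x
coeff (x ∷ f) (suc i) = coeff f i

record _≋_ (f g : Poly) : Set where
  constructor mk≋
  field coeff-≡ : ∀ i → coeff f i ≡ coeff g i
open _≋_

≋-refl : ∀ {f} → f ≋ f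
≋-refl = mk≋ λ i → refl

≡⇒≋ : ∀ {f g} → f ≡ g → f ≋ g
≡⇒≋ refl = ≋-refl

≋-sym : ∀ {f g} → f ≋ g → g ≋ f
≋-sym f≋g = mk≋ λ i → sym (coeff-≡ f≋g i)

≋-trans : ∀ {f g h} → f ≋ g → g ≋ h → f ≋ h
≋-trans f≋g g≋h = mk≋ λ i → trans (coeff-≡ f≋g i) (coeff-≡ g≋h i)

coeff-⊕ : ∀ f g i → coeff (f ⊕ g) i ≡ coeff f i + coeff g i
coeff-⊕ []      g       i       = sym (ℤ.+-identityˡ (coeff g i))
coeff-⊕ (x ∷ f) []      i       = sym (ℤ.+-identityʳ (coeff (x ∷ f) i))
coeff-⊕ (x ∷ f) (y ∷ g) zero    = refl
coeff-⊕ (x ∷ f) (y ∷ g) (suc i) = coeff-⊕ f g i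

coeff-scale : ∀ c f i → coeff (scale c f) i ≡ c * coeff f i
coeff-scale c []      i       = sym (ℤ.*-zeroʳ c)
coeff-scale c (x ∷ f) zero    = refl
coeff-scale c (x ∷ f) (suc i) = coeff-scale c f i

coeff-zeros : ∀ k i → coeff (zeros k) i ≡ 0ℤ
coeff-zeros zero    i       = refl
coeff-zeros (suc k) zero    = refl
coeff-zeros (suc k) (suc i) = coeff-zeros k i

pad≋ : ∀ k f → pad k f ≋ f
pad≋ k f = mk≋ (coeff-pad k f)
  where
  coeff-pad : ∀ k f i → coeff (pad k f) i ≡ coeff f i
  coeff-pad k []      i       = coeff-zeros k i
  coeff-pad k (x ∷ f) zero    = refl
  coeff-pad k (x ∷ f) (suc i) = coeff-pad k f i

[]≋[0] : [] ≋ [ 0ℤ ]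
[]≋[0] = mk≋ λ { zero → refl ; (suc i) → refl }

⊕-cong≋ : ∀ {f f' g g'} → f ≋ f' → g ≋ g' → (f ⊕ g) ≋ (f' ⊕ g')
⊕-cong≋ {f} {f'} {g} {g'} f≋f' g≋g' = mk≋ λ i →
  trans (coeff-⊕ f g i) (trans (cong₂ _+_ (coeff-≡ f≋f' i) (coeff-≡ g≋g' i)) (sym (coeff-⊕ f' g' i)))

scale-cong≋ : ∀ c {f g} → f ≋ g → scale c f ≋ scale c g
scale-cong≋ c {f} {g} f≋g = mk≋ λ i →
  trans (coeff-scale c f i) (trans (cong (c *_) (coeff-≡ f≋g i)) (sym (coeff-scale c g i)))

∷-cong≋ : ∀ x {f g} → f ≋ g → (x ∷ f) ≋ (x ∷ g)
∷-cong≋ x f≋g = mk≋ λ { zero → refl ; (suc i) → coeff-≡ f≋g i }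

⊗-congʳ≋ : ∀ f {g g'} → g ≋ g' → (f ⊗ g) ≋ (f ⊗ g')
⊗-congʳ≋ []      g≋g' = ≋-refl
⊗-congʳ≋ (x ∷ f) g≋g' = ⊕-cong≋ (scale-cong≋ x g≋g') (∷-cong≋ 0ℤ (⊗-congʳ≋ f g≋g'))

scale-one : ∀ f → scale 1ℤ f ≡ f
scale-one []      = refl
scale-one (x ∷ f) = cong₂ _∷_ (ℤ.*-identityˡ x) (scale-one f)

scale-zero-⊕≋ : ∀ f g → (scale 0ℤ f ⊕ g) ≋ g
scale-zero-⊕≋ f g = mk≋ λ i → begin
  coeff (scale 0ℤ f ⊕ g) i         ≡⟨ coeff-⊕ (scale 0ℤ f) g i ⟩
  coeff (scale 0ℤ f) i + coeff g i ≡⟨ cong (_+ coeff g i) (coeff-scale 0ℤ f i) ⟩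
  0ℤ + coeff g i                   ≡⟨ ℤ.+-identityˡ (coeff g i) ⟩
  coeff g i                        ∎

⊕-zeros≋ : ∀ k f → (f ⊕ zeros k) ≋ f
⊕-zeros≋ k f = mk≋ λ i → begin
  coeff (f ⊕ zeros k) i            ≡⟨ coeff-⊕ f (zeros k) i ⟩
  coeff f i + coeff (zeros k) i    ≡⟨ cong (λ z → coeff f i + z) (coeff-zeros k i) ⟩
  coeff f i + 0ℤ                   ≡⟨ ℤ.+-identityʳ (coeff f i) ⟩
  coeff f i                        ∎

qint-⊗≋ : ∀ k x → (qint (suc k) ⊗ x) ≋ qsum k x
qint-⊗≋ zero    x = ≋-trans (⊕-zeros≋ 1 (scale 1ℤ x)) (≡⇒≋ (scale-one x))
qint-⊗≋ (suc k) x = ⊕-cong≋ (≋-trans (≡⇒≋ (scale-one x)) (≋-sym (pad≋ (suc k) x))) (∷-cong≋ 0ℤ (qint-⊗≋ k x))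

qpow-⊗≋ : ∀ k y → (qpow k ⊗ y) ≋ shift k y
qpow-⊗≋ zero    y = qint-⊗≋ 0 y
qpow-⊗≋ (suc k) y = ≋-trans (scale-zero-⊕≋ y (0ℤ ∷ (qpow k ⊗ y))) (∷-cong≋ 0ℤ (qpow-⊗≋ k y))

vec : List ℕ → Poly × Poly
vec []       = [ 1ℤ ] , []
vec (c ∷ cs) = Mq c (vec cs)

vec≋padVec : ∀ cs → All (1 ≤_) cs → (proj₁ (vec cs) ≋ proj₁ (padVec cs)) × (proj₂ (vec cs) ≋ proj₂ (padVec cs))
vec≋padVec []            []          = ≋-refl , []≋[0]
vec≋padVec (suc k ∷ cs) (_ ∷ cs≥1) with vec≋padVec cs cs≥1
... | x≋ , t≋ =
  ⊕-cong≋ (≋-trans (⊗-congʳ≋ (qint (suc k)) x≋) (qint-⊗≋ k (𝓡 cs)))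
          (scale-cong≋ -1ℤ (≋-trans (⊗-congʳ≋ (qpow k) t≋) (qpow-⊗≋ k (proj₂ (padVec cs)))))
  , ≋-trans x≋ (≋-sym (pad≋ k (𝓡 cs)))

-- the step function of norm, which Defs keeps local to norm's where block
normStep : ℤ → Poly → Poly
normStep x []       = if does (x ℤ.≟ 0ℤ) then [] else [ x ]
normStep x (y ∷ ys) = x ∷ y ∷ ys

norm-∷ : ∀ x f → norm (x ∷ f) ≡ normStep x (norm f)
norm-∷ x f with norm f
... | []     = refl
... | y ∷ ys = refl

≋⇒norm≡ : ∀ {f g} → f ≋ g → norm f ≡ norm g
≋⇒norm≡ {f} {g} f≋g = go f g (coeff-≡ f≋g)
  where
  go : ∀ f g → (∀ i → coeff f i ≡ coeff g i) → norm f ≡ norm g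
  go []      []      eq = refl
  go []      (y ∷ g) eq with eq 0
  ... | refl = trans (cong (normStep 0ℤ) (go [] g (eq ∘ suc))) (sym (norm-∷ 0ℤ g))
  go (x ∷ f) []      eq with eq 0
  ... | refl = trans (norm-∷ 0ℤ f) (cong (normStep 0ℤ) (go f [] (eq ∘ suc)))
  go (x ∷ f) (y ∷ g) eq =
    trans (norm-∷ x f) (trans (cong₂ normStep (eq 0) (go f g (eq ∘ suc))) (sym (norm-∷ y g)))

norm-∷ʳ-1 : ∀ xs → norm (xs ++ [ 1ℤ ]) ≡ xs ++ [ 1ℤ ]
norm-∷ʳ-1 []           = refl
norm-∷ʳ-1 (x ∷ [])     = refl
norm-∷ʳ-1 (x ∷ y ∷ xs) = trans (norm-∷ x (y ∷ xs ++ [ 1ℤ ])) (cong (normStep x) (norm-∷ʳ-1 (y ∷ xs)))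

𝓡-constant-one : ∀ cs → All (2 ≤_) cs → Σ[ rest ∈ Poly ] 𝓡 cs ≡ 1ℤ ∷ rest
𝓡-constant-one []                 []          = [] , refl
𝓡-constant-one (suc zero ∷ cs)     (s≤s () ∷ _)
𝓡-constant-one (suc (suc k) ∷ cs) (_ ∷ cs≥2) with 𝓡-constant-one cs cs≥2
... | rest , eq rewrite eq = _ , refl

All-reverse : ∀ {P : ℕ → Set} xs → All P xs → All P (reverse xs)
All-reverse         []       []         = []
All-reverse {P = P} (x ∷ xs) (px ∷ pxs) =
  subst (All P) (sym (List.unfold-reverse x xs)) (All.∷ʳ⁺ (All-reverse xs pxs) px)

-- 𝓡 has constant term 1, so its reverse ends in 1 and is already normalised.
vec-reverse-dual : ∀ cs → All (2 ≤_) cs → proj₁ (vec cs) ≈P dual (proj₁ (vec (reverse cs)))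
vec-reverse-dual cs cs≥2 with 𝓡-constant-one cs cs≥2
... | rest , 𝓡≡ = begin
  norm (proj₁ (vec cs))                    ≡⟨ ≋⇒norm≡ (vec≋𝓡 cs cs≥2) ⟩
  norm (𝓡 cs)                              ≡⟨ cong norm (sym reverse-𝓡ʳ) ⟩
  norm (reverse (𝓡 csʳ))                   ≡⟨ cong (norm ∘ reverse) (sym norm-𝓡ʳ) ⟩
  norm (reverse (norm (𝓡 csʳ)))
    ≡⟨ cong (norm ∘ reverse) (sym (≋⇒norm≡ (vec≋𝓡 csʳ (All-reverse cs cs≥2)))) ⟩
  norm (reverse (norm (proj₁ (vec csʳ))))  ∎
  where
  csʳ = reverse cs
  vec≋𝓡 : ∀ cs → All (2 ≤_) cs → proj₁ (vec cs) ≋ 𝓡 cs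
  vec≋𝓡 ds ds≥2 = proj₁ (vec≋padVec ds (All.map (ℕ.≤-trans (s≤s z≤n)) ds≥2))
  𝓡ʳ≡ : 𝓡 csʳ ≡ reverse rest ++ [ 1ℤ ]
  𝓡ʳ≡ = trans (sym (reverse-𝓡 cs)) (trans (cong reverse 𝓡≡) (List.unfold-reverse 1ℤ rest))
  norm-𝓡ʳ : norm (𝓡 csʳ) ≡ 𝓡 csʳ
  norm-𝓡ʳ = trans (cong norm 𝓡ʳ≡) (trans (norm-∷ʳ-1 (reverse rest)) (sym 𝓡ʳ≡))
  reverse-𝓡ʳ : reverse (𝓡 csʳ) ≡ 𝓡 cs
  reverse-𝓡ʳ = trans (cong reverse (sym (reverse-𝓡 cs))) (List.reverse-involutive (𝓡 cs))

-- Negative continued fractions of natural numbers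

-- Expansion cs g r s : (r , s)ᵀ = M(c₁) ⋯ M(cₗ) (g , 0)ᵀ with M(c) = [[c , -1] , [1 , 0]],
-- i.e. cs is the negative continued fraction of r/s and g = gcd(r, s).
data Expansion : List ℕ → ℕ → ℕ → ℕ → Set where
  done : ∀ {g} → Expansion [] g g 0
  step : ∀ {cs g r s c R} → Expansion cs g r s → r ℕ.* c ≡ R ℕ.+ s → Expansion (c ∷ cs) g R r

Expansion-bounds : ∀ {cs g r s} → 1 ≤ g → All (2 ≤_) cs → Expansion cs g r s → s < r × length cs ≤ s
Expansion-bounds g≥1 []          done = g≥1 , z≤n
Expansion-bounds {r = R} g≥1 (c≥2 ∷ cs≥2) (step {r = r} {s = s} {c = c} e eq)
  with Expansion-bounds g≥1 cs≥2 e
... | s<r , length≤s = r<R , ℕ.≤-<-trans length≤s s<r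
  where
  r+r≤r*c : r ℕ.+ r ≤ r ℕ.* c
  r+r≤r*c = subst (_≤ r ℕ.* c) (trans (ℕ.*-comm r 2) (cong (r ℕ.+_) (ℕ.+-identityʳ r))) (ℕ.*-monoʳ-≤ r c≥2)
  r<R : r < R
  r<R = ℕ.+-cancelʳ-< s r R (ℕ.<-≤-trans (ℕ.+-monoʳ-< r s<r) (ℕ.≤-trans r+r≤r*c (ℕ.≤-reflexive eq)))

ceiling-division : ∀ r s' → Σ[ c ∈ ℕ ] Σ[ d ∈ ℕ ] (suc s' ℕ.* c ≡ r ℕ.+ d) × (d ≤ s')
ceiling-division r s' = c , d , eq , ℕ.m∸n≤m s' m
  where
  c = (r ℕ.+ s') / suc s'
  m = (r ℕ.+ s') % suc s'
  d = s' ∸ m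
  d+m≡s' : d ℕ.+ m ≡ s'
  d+m≡s' = ℕ.m∸n+n≡m (ℕ.≤-pred (m%n<n (r ℕ.+ s') (suc s')))
  eq : suc s' ℕ.* c ≡ r ℕ.+ d
  eq = ℕ.+-cancelʳ-≡ m (suc s' ℕ.* c) (r ℕ.+ d) (begin
    suc s' ℕ.* c ℕ.+ m   ≡⟨ ℕ.+-comm (suc s' ℕ.* c) m ⟩
    m ℕ.+ suc s' ℕ.* c   ≡⟨ cong (m ℕ.+_) (ℕ.*-comm (suc s') c) ⟩
    m ℕ.+ c ℕ.* suc s'   ≡⟨ m≡m%n+[m/n]*n (r ℕ.+ s') (suc s') ⟨
    r ℕ.+ s'             ≡⟨ cong (r ℕ.+_) d+m≡s' ⟨
    r ℕ.+ (d ℕ.+ m)      ≡⟨ ℕ.+-assoc r d m ⟨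
    r ℕ.+ d ℕ.+ m        ∎)

cfVec-digit : ∀ r s' c d → suc s' ℕ.* c ≡ r ℕ.+ d → d ≤ s' →
  ((r ℕ.+ s') / suc s' ≡ c) × (suc s' ℕ.* c ∸ r ≡ d)
cfVec-digit r s' c d eq d≤s' = quotient≡c , trans (cong (_∸ r) eq) (ℕ.m+n∸m≡n r d)
  where
  x = s' ∸ d
  x+d≡s' : x ℕ.+ d ≡ s'
  x+d≡s' = ℕ.m∸n+n≡m d≤s'
  r+s'≡x+c*s : r ℕ.+ s' ≡ x ℕ.+ c ℕ.* suc s'
  r+s'≡x+c*s = ℕ.+-cancelʳ-≡ d (r ℕ.+ s') (x ℕ.+ c ℕ.* suc s') (begin
    r ℕ.+ s' ℕ.+ d                  ≡⟨ ℕ.+-assoc r s' d ⟩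
    r ℕ.+ (s' ℕ.+ d)                ≡⟨ cong (r ℕ.+_) (ℕ.+-comm s' d) ⟩
    r ℕ.+ (d ℕ.+ s')                ≡⟨ ℕ.+-assoc r d s' ⟨
    (r ℕ.+ d) ℕ.+ s'                ≡⟨ cong (ℕ._+ s') eq ⟨
    suc s' ℕ.* c ℕ.+ s'             ≡⟨ cong (suc s' ℕ.* c ℕ.+_) x+d≡s' ⟨
    suc s' ℕ.* c ℕ.+ (x ℕ.+ d)      ≡⟨ ℕ.+-assoc (suc s' ℕ.* c) x d ⟨
    suc s' ℕ.* c ℕ.+ x ℕ.+ d
      ≡⟨ cong (ℕ._+ d) (trans (ℕ.+-comm (suc s' ℕ.* c) x) (cong (x ℕ.+_) (ℕ.*-comm (suc s') c))) ⟩
    x ℕ.+ c ℕ.* suc s' ℕ.+ d        ∎)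
  quotient≡c : (r ℕ.+ s') / suc s' ≡ c
  quotient≡c = trans (/-congˡ r+s'≡x+c*s) (trans (+-distrib-/-∣ʳ x (n∣m*n c))
    (cong₂ ℕ._+_ (m<n⇒m/n≡0 (s≤s (ℕ.m∸n≤m s' d))) (m*n/n≡m c (suc s'))))

-- cfVec branches on suc s' * ((r + s') / suc s') ∸ r; these lemmas evaluate that branch.
cfVec-last : ∀ f r s' c → suc s' ℕ.* c ≡ r ℕ.+ 0 → cfVec (suc f) r (suc s') ≡ Mq c ([ 1ℤ ] , [])
cfVec-last f r s' c eq with suc s' ℕ.* ((r ℕ.+ s') / suc s') ∸ r in next | cfVec-digit r s' c 0 eq z≤n
... | zero  | quotient≡c , _      = cong (λ c → Mq c ([ 1ℤ ] , [])) quotient≡c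
... | suc _ | quotient≡c , next≡0 =
  contradiction (trans (sym next) (trans (cong (λ c → suc s' ℕ.* c ∸ r) quotient≡c) next≡0)) ℕ.1+n≢0

cfVec-step : ∀ f r s' c d → suc s' ℕ.* c ≡ r ℕ.+ suc d → suc d ≤ s' →
  cfVec (suc f) r (suc s') ≡ Mq c (cfVec f (suc s') (suc d))
cfVec-step f r s' c d eq d<s' with suc s' ℕ.* ((r ℕ.+ s') / suc s') ∸ r in next | cfVec-digit r s' c (suc d) eq d<s'
... | zero   | quotient≡c , next≡d =
  contradiction (trans (sym next≡d) (trans (cong (λ c → suc s' ℕ.* c ∸ r) (sym quotient≡c)) next)) ℕ.1+n≢0
... | suc d' | quotient≡c , next≡d = cong₂ (λ c e → Mq c (cfVec f (suc s') e)) quotient≡c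
  (trans (sym next) (trans (cong (λ c → suc s' ℕ.* c ∸ r) quotient≡c) next≡d))

cfVec-expansion : ∀ {cs g r s} fuel → 1 ≤ g → All (2 ≤_) cs → Expansion cs g r s → 1 ≤ s → length cs ≤ fuel →
  cfVec fuel r s ≡ vec cs
cfVec-expansion _ _ _ done () _
cfVec-expansion {g = suc g'} (suc f) _ _ (step {c = c} done eq) _ _ = cfVec-last f _ g' c eq
cfVec-expansion (suc f) g≥1 (_ ∷ cs≥2) (step {cs = _ ∷ _} {r = suc r'} {s = suc d} {c = c} e eq) _ (s≤s length≤f) =
  trans (cfVec-step f _ r' c d eq (ℕ.≤-pred (proj₁ (Expansion-bounds g≥1 cs≥2 e))))
        (cong (Mq c) (cfVec-expansion f g≥1 cs≥2 e (s≤s z≤n) length≤f))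

ceiling-digit≥2 : ∀ r s' c d → suc s' ℕ.* c ≡ r ℕ.+ d → suc s' < r → 2 ≤ c
ceiling-digit≥2 r s' zero d eq s<r =
  contradiction (trans (sym (ℕ.*-zeroʳ (suc s'))) eq)
    (ℕ.<⇒≢ (ℕ.<-≤-trans (s≤s z≤n) (ℕ.≤-trans (ℕ.<⇒≤ s<r) (ℕ.m≤m+n r d))))
ceiling-digit≥2 r s' (suc zero) d eq s<r =
  contradiction (ℕ.≤-trans (ℕ.m≤m+n r d) (ℕ.≤-reflexive (trans (sym eq) (ℕ.*-identityʳ (suc s'))))) (ℕ.<⇒≱ s<r)
ceiling-digit≥2 r s' (suc (suc c)) d eq s<r = s≤s (s≤s z≤n)

expansion-exists : ∀ r s → 1 ≤ s → s < r →
  Σ[ g ∈ ℕ ] Σ[ cs ∈ List ℕ ] 1 ≤ g × All (2 ≤_) cs × Expansion cs g r s × g ∣ℕ r × g ∣ℕ s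
expansion-exists r s = go s r s ℕ.≤-refl
  where
  go : ∀ fuel r s → s ≤ fuel → 1 ≤ s → s < r →
    Σ[ g ∈ ℕ ] Σ[ cs ∈ List ℕ ] 1 ≤ g × All (2 ≤_) cs × Expansion cs g r s × g ∣ℕ r × g ∣ℕ s
  go zero     r (suc s') () _ _
  go (suc fuel) r (suc s') s≤fuel _ s<r with ceiling-division r s'
  ... | c , zero , eq , _ =
    suc s' , c ∷ [] , s≤s z≤n , ceiling-digit≥2 r s' c 0 eq s<r ∷ [] , step done eq ,
    divides c (trans (sym (trans eq (ℕ.+-identityʳ r))) (ℕ.*-comm (suc s') c)) , ∣ℕ-refl
  ... | c , suc d , eq , d<s' with go fuel (suc s') (suc d) (ℕ.≤-trans d<s' (ℕ.≤-pred s≤fuel)) (s≤s z≤n) (s≤s d<s')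
  ...   | g , cs , g≥1 , cs≥2 , e , g∣s , g∣d =
    g , c ∷ cs , g≥1 , ceiling-digit≥2 r s' c (suc d) eq s<r ∷ cs≥2 , step e eq , g∣r , g∣s
    where
    g∣r : g ∣ℕ r
    g∣r = ∣m+n∣m⇒∣n (subst (g ∣ℕ_) (trans eq (ℕ.+-comm r (suc d))) (∣m⇒∣m*n c g∣s)) g∣d

digits-expansion : ∀ cs → All (2 ≤_) cs → Σ[ r ∈ ℕ ] Σ[ s ∈ ℕ ] Expansion cs 1 r s
digits-expansion []       []          = 1 , 0 , done
digits-expansion (c ∷ cs) (c≥2 ∷ cs≥2) with digits-expansion cs cs≥2
... | r , s , e = r ℕ.* c ∸ s , r , step e (sym (ℕ.m∸n+n≡m s≤r*c))
  where
  s≤r*c : s ≤ r ℕ.* c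
  s≤r*c = ℕ.≤-trans (ℕ.<⇒≤ (proj₁ (Expansion-bounds (s≤s z≤n) cs≥2 e)))
    (ℕ.≤-trans (ℕ.≤-reflexive (sym (ℕ.*-identityʳ r))) (ℕ.*-monoʳ-≤ r (ℕ.≤-trans (s≤s z≤n) c≥2)))

-- 2 × 2 integer matrices

record Mat : Set where
  constructor mat
  field m₁₁ m₁₂ m₂₁ m₂₂ : ℤ
open Mat

_·_ : Mat → Mat → Mat
X · Y = mat (m₁₁ X * m₁₁ Y + m₁₂ X * m₂₁ Y) (m₁₁ X * m₁₂ Y + m₁₂ X * m₂₂ Y)
            (m₂₁ X * m₁₁ Y + m₂₂ X * m₂₁ Y) (m₂₁ X * m₁₂ Y + m₂₂ X * m₂₂ Y)

I : Mat
I = mat 1ℤ 0ℤ 0ℤ 1ℤ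

det : Mat → ℤ
det X = m₁₁ X * m₂₂ X - m₁₂ X * m₂₁ X

-- X ↦ D Xᵀ D with D = diag(1, -1): an anti-automorphism fixing every digitMat c
twist : Mat → Mat
twist X = mat (m₁₁ X) (- m₂₁ X) (- m₁₂ X) (m₂₂ X)

-- M⁻_q(c) at q = 1
digitMat : ℕ → Mat
digitMat c = mat (+ c) -1ℤ 1ℤ 0ℤ

digitsMat : List ℕ → Mat
digitsMat []       = I
digitsMat (c ∷ cs) = digitMat c · digitsMat cs

mat-≡ : ∀ {X Y} → m₁₁ X ≡ m₁₁ Y → m₁₂ X ≡ m₁₂ Y → m₂₁ X ≡ m₂₁ Y → m₂₂ X ≡ m₂₂ Y → X ≡ Y
mat-≡ refl refl refl refl = refl

·-assoc : ∀ X Y Z → (X · Y) · Z ≡ X · (Y · Z)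
·-assoc X Y Z = mat-≡
  (entry (m₁₁ X) (m₁₂ X) (m₁₁ Y) (m₁₂ Y) (m₂₁ Y) (m₂₂ Y) (m₁₁ Z) (m₂₁ Z))
  (entry (m₁₁ X) (m₁₂ X) (m₁₁ Y) (m₁₂ Y) (m₂₁ Y) (m₂₂ Y) (m₁₂ Z) (m₂₂ Z))
  (entry (m₂₁ X) (m₂₂ X) (m₁₁ Y) (m₁₂ Y) (m₂₁ Y) (m₂₂ Y) (m₁₁ Z) (m₂₁ Z))
  (entry (m₂₁ X) (m₂₂ X) (m₁₁ Y) (m₁₂ Y) (m₂₁ Y) (m₂₂ Y) (m₁₂ Z) (m₂₂ Z))
  where
  entry : ∀ x₁ x₂ y₁₁ y₁₂ y₂₁ y₂₂ z₁ z₂ →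
    (x₁ * y₁₁ + x₂ * y₂₁) * z₁ + (x₁ * y₁₂ + x₂ * y₂₂) * z₂
    ≡ x₁ * (y₁₁ * z₁ + y₁₂ * z₂) + x₂ * (y₂₁ * z₁ + y₂₂ * z₂)
  entry = solve-∀

1a+0b≡a : ∀ a b → 1ℤ * a + 0ℤ * b ≡ a
1a+0b≡a = solve-∀

·-identityˡ : ∀ X → I · X ≡ X
·-identityˡ X = mat-≡ (1a+0b≡a (m₁₁ X) (m₂₁ X)) (1a+0b≡a (m₁₂ X) (m₂₂ X))
                      (0a+1b≡b (m₁₁ X) (m₂₁ X)) (0a+1b≡b (m₁₂ X) (m₂₂ X))
  where
  0a+1b≡b : ∀ a b → 0ℤ * a + 1ℤ * b ≡ b
  0a+1b≡b = solve-∀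

·-identityʳ : ∀ X → X · I ≡ X
·-identityʳ X = mat-≡ (a1+b0≡a (m₁₁ X) (m₁₂ X)) (a0+b1≡b (m₁₁ X) (m₁₂ X))
                      (a1+b0≡a (m₂₁ X) (m₂₂ X)) (a0+b1≡b (m₂₁ X) (m₂₂ X))
  where
  a1+b0≡a : ∀ a b → a * 1ℤ + b * 0ℤ ≡ a
  a1+b0≡a = solve-∀
  a0+b1≡b : ∀ a b → a * 0ℤ + b * 1ℤ ≡ b
  a0+b1≡b = solve-∀

twist-· : ∀ X Y → twist (X · Y) ≡ twist Y · twist X
twist-· X Y = mat-≡
  (ab+cd≡ba+[-d][-c] (m₁₁ X) (m₁₁ Y) (m₁₂ X) (m₂₁ Y))
  (-[ab+cd]≡b[-a]+[-d]c (m₂₁ X) (m₁₁ Y) (m₂₂ X) (m₂₁ Y))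
  (-[ab+cd]≡[-b]a+d[-c] (m₁₁ X) (m₁₂ Y) (m₁₂ X) (m₂₂ Y))
  (ab+cd≡[-b][-a]+dc (m₂₁ X) (m₁₂ Y) (m₂₂ X) (m₂₂ Y))
  where
  ab+cd≡ba+[-d][-c] : ∀ a b c d → a * b + c * d ≡ b * a + (- d) * (- c)
  ab+cd≡ba+[-d][-c] = solve-∀
  -[ab+cd]≡b[-a]+[-d]c : ∀ a b c d → - (a * b + c * d) ≡ b * (- a) + (- d) * c
  -[ab+cd]≡b[-a]+[-d]c = solve-∀
  -[ab+cd]≡[-b]a+d[-c] : ∀ a b c d → - (a * b + c * d) ≡ (- b) * a + d * (- c)
  -[ab+cd]≡[-b]a+d[-c] = solve-∀
  ab+cd≡[-b][-a]+dc : ∀ a b c d → a * b + c * d ≡ (- b) * (- a) + d * c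
  ab+cd≡[-b][-a]+dc = solve-∀

digitsMat-++ : ∀ xs c → digitsMat (xs ++ [ c ]) ≡ digitsMat xs · digitMat c
digitsMat-++ []       c = trans (·-identityʳ (digitMat c)) (sym (·-identityˡ (digitMat c)))
digitsMat-++ (x ∷ xs) c = trans (cong (digitMat x ·_) (digitsMat-++ xs c)) (sym (·-assoc (digitMat x) (digitsMat xs) (digitMat c)))

digitsMat-reverse : ∀ cs → digitsMat (reverse cs) ≡ twist (digitsMat cs)
digitsMat-reverse []       = refl
digitsMat-reverse (c ∷ cs) = begin
  digitsMat (reverse (c ∷ cs))             ≡⟨ cong digitsMat (List.unfold-reverse c cs) ⟩
  digitsMat (reverse cs ++ [ c ])          ≡⟨ digitsMat-++ (reverse cs) c ⟩
  digitsMat (reverse cs) · digitMat c      ≡⟨ cong (_· digitMat c) (digitsMat-reverse cs) ⟩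
  twist (digitsMat cs) · twist (digitMat c) ≡⟨ twist-· (digitMat c) (digitsMat cs) ⟨
  twist (digitsMat (c ∷ cs))               ∎

det-digitsMat : ∀ cs → det (digitsMat cs) ≡ 1ℤ
det-digitsMat []       = refl
det-digitsMat (c ∷ cs) = trans (det-digitMat· (+ c) (m₁₁ X) (m₁₂ X) (m₂₁ X) (m₂₂ X)) (det-digitsMat cs)
  where
  X = digitsMat cs
  det-digitMat· : ∀ c a b e f →
    (c * a + -1ℤ * e) * (1ℤ * b + 0ℤ * f) - (c * b + -1ℤ * f) * (1ℤ * a + 0ℤ * e) ≡ a * f - b * e
  det-digitMat· = solve-∀

digitsMat-column : ∀ {cs r s} → Expansion cs 1 r s → (m₁₁ (digitsMat cs) ≡ + r) × (m₂₁ (digitsMat cs) ≡ + s)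
digitsMat-column done = refl , refl
digitsMat-column {c ∷ cs} (step {r = r} {s = s} {c = c} {R = R} e eq) with digitsMat-column e
... | m₁₁≡r , m₂₁≡s = first , trans (1a+0b≡a (m₁₁ (digitsMat cs)) (m₂₁ (digitsMat cs))) m₁₁≡r
  where
  first : + c * m₁₁ (digitsMat cs) + -1ℤ * m₂₁ (digitsMat cs) ≡ + R
  first = begin
    + c * m₁₁ (digitsMat cs) + -1ℤ * m₂₁ (digitsMat cs) ≡⟨ cong₂ (λ u v → + c * u + -1ℤ * v) m₁₁≡r m₂₁≡s ⟩
    + c * + r + -1ℤ * + s                               ≡⟨ cong (λ z → z + -1ℤ * + s) (ℤ.pos-* c r) ⟨
    + (c ℕ.* r) + -1ℤ * + s                             ≡⟨ cong (λ z → + z + -1ℤ * + s) (trans (ℕ.*-comm c r) eq) ⟩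
    + (R ℕ.+ s) + -1ℤ * + s                             ≡⟨ cong (_+ -1ℤ * + s) (ℤ.pos-+ R s) ⟩
    + R + + s + -1ℤ * + s                               ≡⟨ x+y-y≡x (+ R) (+ s) ⟩
    + R                                                  ∎
    where
    x+y-y≡x : ∀ x y → x + y + -1ℤ * y ≡ x
    x+y-y≡x = solve-∀

-- Residues modulo P

∣ₛ-linear : ∀ {k x y} → k ∣ₛ x → k ∣ₛ y → ∀ m n → k ∣ₛ m * x + n * y
∣ₛ-linear k∣x k∣y m n = Signed.∣m∣n⇒∣m+n (Signed.∣n⇒∣m*n m k∣x) (Signed.∣n⇒∣m*n n k∣y)

∣ₛ-resp-≡ : ∀ {k x y} → x ≡ y → k ∣ₛ x → k ∣ₛ y
∣ₛ-resp-≡ refl k∣x = k∣x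

∣ₛ1⇒≡1 : ∀ {g} → + g ∣ₛ 1ℤ → g ≡ 1
∣ₛ1⇒≡1 g∣1 = ∣1⇒≡1 (Signed.∣⇒∣ᵤ g∣1)

∣-<⇒≡0 : ∀ {p n} → p ∣ℕ n → n < p → n ≡ 0
∣-<⇒≡0 {n = zero}  _   _   = refl
∣-<⇒≡0 {n = suc n} p∣n n<p = contradiction (∣⇒≤ p∣n) (ℕ.<⇒≱ n<p)

residue-unique : ∀ p x y → + p ∣ₛ + x - + y → x < p → y < p → x ≡ y
residue-unique p x y p∣x-y x<p y<p = ℤ.+-injective (ℤ.i-j≡0⇒i≡j (+ x) (+ y) (ℤ.∣i∣≡0⇒i≡0 ∣x-y∣≡0))
  where
  ∣x-y∣<p : ∣ + x - + y ∣ < p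
  ∣x-y∣<p = ℕ.≤-<-trans (subst (_≤ x ℕ.⊔ y) (cong ∣_∣ (sym (ℤ.m-n≡m⊖n x y))) (ℤ.∣m⊝n∣≤m⊔n x y))
                        (ℕ.⊔-lub x<p y<p)
  ∣x-y∣≡0 : ∣ + x - + y ∣ ≡ 0
  ∣x-y∣≡0 = ∣-<⇒≡0 (Signed.∣⇒∣ᵤ p∣x-y) ∣x-y∣<p

-- Reversal acts on digitsMat by twist, and det (digitsMat cs) = 1.
reverse-expansion : ∀ {cs P u} → All (2 ≤_) cs → Expansion cs 1 P u →
  Σ[ u' ∈ ℕ ] Expansion (reverse cs) 1 P u' × (+ P ∣ₛ + u' * + u - 1ℤ)
reverse-expansion {cs} {P} {u} cs≥2 e with digits-expansion (reverse cs) (All-reverse cs cs≥2)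
... | r' , u' , e' = u' , subst (λ r → Expansion (reverse cs) 1 r u') r'≡P e' , P∣u'u-1
  where
  X = digitsMat cs
  column = digitsMat-column e
  column' = digitsMat-column e'
  r'≡P : r' ≡ P
  r'≡P = ℤ.+-injective (trans (sym (proj₁ column')) (trans (cong m₁₁ (digitsMat-reverse cs)) (proj₁ column)))
  u'≡-m₁₂ : + u' ≡ - m₁₂ X
  u'≡-m₁₂ = trans (sym (proj₂ column')) (cong m₂₁ (digitsMat-reverse cs))
  det≡1 : + P * m₂₂ X - m₁₂ X * + u ≡ 1ℤ
  det≡1 = subst₂ (λ a c → a * m₂₂ X - m₁₂ X * c ≡ 1ℤ) (proj₁ column) (proj₂ column) (det-digitsMat cs)
  [-b]u-[Pd-bu]≡[-d]P : ∀ b d P u → (- b) * u - (P * d - b * u) ≡ (- d) * P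
  [-b]u-[Pd-bu]≡[-d]P = solve-∀
  P∣u'u-1 : + P ∣ₛ + u' * + u - 1ℤ
  P∣u'u-1 = Signed.divides (- m₂₂ X) (begin
    + u' * + u - 1ℤ                      ≡⟨ cong₂ (λ a c → a * + u - c) u'≡-m₁₂ (sym det≡1) ⟩
    (- m₁₂ X) * + u - (+ P * m₂₂ X - m₁₂ X * + u) ≡⟨ [-b]u-[Pd-bu]≡[-d]P (m₁₂ X) (m₂₂ X) (+ P) (+ u) ⟩
    (- m₂₂ X) * + P                      ∎)

-- The gcd g of P and u divides both u v and u v - 1.
coprime-expansion : ∀ P u v → 1 ≤ u → u < P → + P ∣ₛ + u * + v - 1ℤ →
  Σ[ cs ∈ List ℕ ] All (2 ≤_) cs × Expansion cs 1 P u
coprime-expansion P u v u≥1 u<P P∣uv-1 with expansion-exists P u u≥1 u<P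
... | g , cs , g≥1 , cs≥2 , e , g∣P , g∣u = cs , cs≥2 , subst (λ g → Expansion cs g P u) g≡1 e
  where
  vu-[uv-1]≡1 : ∀ u v → v * u + -1ℤ * (u * v - 1ℤ) ≡ 1ℤ
  vu-[uv-1]≡1 = solve-∀
  g≡1 : g ≡ 1
  g≡1 = ∣ₛ1⇒≡1 (∣ₛ-resp-≡ (vu-[uv-1]≡1 (+ u) (+ v))
          (∣ₛ-linear (Signed.∣ᵤ⇒∣ g∣u) (Signed.∣-trans (Signed.∣ᵤ⇒∣ g∣P) P∣uv-1) (+ v) -1ℤ))

cfVec-coprime-expansion : ∀ {cs P u} → All (2 ≤_) cs → Expansion cs 1 P u → 1 ≤ u → cfVec P P u ≡ vec cs
cfVec-coprime-expansion {cs} {P} {u} cs≥2 e u≥1 = cfVec-expansion P (s≤s z≤n) cs≥2 e u≥1 (ℕ.<⇒≤ length<P)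
  where
  bounds = Expansion-bounds (s≤s z≤n) cs≥2 e
  length<P : length cs < P
  length<P = ℕ.≤-<-trans (proj₂ bounds) (proj₁ bounds)

inverse-expansions : ∀ P u v → 1 ≤ u → u < P → 1 ≤ v → v < P → + P ∣ₛ + u * + v - 1ℤ →
  Σ[ cs ∈ List ℕ ] All (2 ≤_) cs × (cfVec P P u ≡ vec cs) × (cfVec P P v ≡ vec (reverse cs))
inverse-expansions P u v u≥1 u<P v≥1 v<P P∣uv-1 with coprime-expansion P u v u≥1 u<P P∣uv-1
... | cs , cs≥2 , e with reverse-expansion cs≥2 e
...   | u' , e' , P∣u'u-1 =
  cs , cs≥2 , cfVec-coprime-expansion cs≥2 e u≥1 , subst (λ v → cfVec P P v ≡ vec (reverse cs)) u'≡v
    (cfVec-coprime-expansion (All-reverse cs cs≥2) e' (ℕ.≤-trans v≥1 (ℕ.≤-reflexive (sym u'≡v))))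
  where
  [-w][uv-1]+v[wu-1]≡w-v : ∀ u v w → (- w) * (u * v - 1ℤ) + v * (w * u - 1ℤ) ≡ w - v
  [-w][uv-1]+v[wu-1]≡w-v = solve-∀
  u'≡v : u' ≡ v
  u'≡v = residue-unique P u' v
    (∣ₛ-resp-≡ ([-w][uv-1]+v[wu-1]≡w-v (+ u) (+ v) (+ u')) (∣ₛ-linear P∣uv-1 P∣u'u-1 (- + u') (+ v)))
    (proj₁ (Expansion-bounds (s≤s z≤n) (All-reverse cs cs≥2) e')) v<P

ResidueForm : ℕ → ℤ → Poly → Set
ResidueForm P a f = Σ[ u ∈ ℕ ] 1 ≤ u × u < P × (+ P ∣ₛ a + + u) × (f ≡ proj₁ (cfVec P P u))

-- Shifting a by P changes neither divisibility by P nor the residue class.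
Sfuel-residue : ∀ p' fuel a → + suc p' ℤ.< a + + (fuel ℕ.* suc p') →
  (+ suc p' ∣ₛ a) ⊎ ResidueForm (suc p') a (Sfuel (suc fuel) a (suc p'))
Sfuel-residue p' fuel a P<a+fuel*P with + suc p' ℤ.<? a
Sfuel-residue p' fuel (+ n) _ | yes (ℤ.+<+ P<n) with ceiling-division n p'
... | c , zero , eq , _ =
  inj₁ (Signed.∣ᵤ⇒∣ (divides c (trans (sym (trans eq (ℕ.+-identityʳ n))) (ℕ.*-comm (suc p') c))))
... | c , suc d , eq , d<p' =
  inj₂ (suc d , s≤s z≤n , s≤s d<p' ,
        ∣ₛ-resp-≡ (ℤ.pos-+ n (suc d)) (Signed.∣ᵤ⇒∣ (divides c (trans (sym eq) (ℕ.*-comm (suc p') c)))) ,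
        cong proj₂ (cfVec-step (suc p') n p' c d eq d<p'))
Sfuel-residue p' zero    a P<a | no P≮a = contradiction (subst (+ suc p' ℤ.<_) (ℤ.+-identityʳ a) P<a) P≮a
Sfuel-residue p' (suc f) a P<a+fuel*P | no _ with Sfuel-residue p' f (a + + suc p') P<[a+P]+f*P
  where
  P<[a+P]+f*P : + suc p' ℤ.< (a + + suc p') + + (f ℕ.* suc p')
  P<[a+P]+f*P = subst (+ suc p' ℤ.<_)
    (trans (cong (λ z → a + z) (ℤ.pos-+ (suc p') (f ℕ.* suc p'))) (sym (ℤ.+-assoc a (+ suc p') (+ (f ℕ.* suc p')))))
    P<a+fuel*P
... | inj₁ P∣a+P = inj₁ (Signed.∣m+n∣n⇒∣m P∣a+P Signed.∣-refl)
... | inj₂ (u , u≥1 , u<P , P∣a+P+u , f≡𝓡) =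
  inj₂ (u , u≥1 , u<P ,
        Signed.∣m+n∣n⇒∣m (∣ₛ-resp-≡ (x+y+z≡x+z+y a (+ suc p') (+ u)) P∣a+P+u) Signed.∣-refl , f≡𝓡)

  where
  x+y+z≡x+z+y : ∀ x y z → x + y + z ≡ x + z + y
  x+y+z≡x+z+y = solve-∀

Sfuel-fuel-suffices : ∀ P a → 2 ≤ P → a ≢ 0ℤ → + P ℤ.< a + + (suc ∣ a ∣ ℕ.* P)
Sfuel-fuel-suffices P (+ zero)   _   a≢0 = contradiction refl a≢0
Sfuel-fuel-suffices P (+ suc n)  _   _   = ℤ.+<+ (s≤s (ℕ.≤-trans (ℕ.m≤m+n P _) (ℕ.m≤n+m _ n)))
Sfuel-fuel-suffices P -[1+ n ]   P≥2 _   =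
  subst (+ P ℤ.<_) value (ℤ.+<+ (ℕ.m<m+n P (ℕ.m<n⇒0<n∸m 1+n<m)))
  where
  m = suc n ℕ.* P
  1+n<m : suc n < m
  1+n<m = ℕ.≤-<-trans (ℕ.≤-reflexive (sym (ℕ.*-identityʳ (suc n)))) (ℕ.*-monoʳ-< (suc n) P≥2)
  value : + (P ℕ.+ (m ∸ suc n)) ≡ -[1+ n ] + + (suc (suc n) ℕ.* P)
  value = begin
    + (P ℕ.+ (m ∸ suc n))               ≡⟨ cong +_ (ℕ.+-∸-assoc P (ℕ.<⇒≤ 1+n<m)) ⟨
    + (P ℕ.+ m ∸ suc n)                 ≡⟨ ℤ.⊖-≥ (ℕ.≤-trans (ℕ.<⇒≤ 1+n<m) (ℕ.m≤n+m m P)) ⟨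
    -[1+ n ] + + (suc (suc n) ℕ.* P)    ∎

qS-residue : ∀ P a → 2 ≤ P → (+ P ∣ₛ a) ⊎ ResidueForm P a (qS a P)
qS-residue P           (+ zero)  _   = inj₁ (Signed.divides 0ℤ (sym (ℤ.*-zeroˡ (+ P))))
qS-residue (suc p') a@(+ suc n) P≥2 = Sfuel-residue p' (suc ∣ a ∣) a (Sfuel-fuel-suffices (suc p') a P≥2 λ ())
qS-residue (suc p') a@(-[1+ n ]) P≥2 = Sfuel-residue p' (suc ∣ a ∣) a (Sfuel-fuel-suffices (suc p') a P≥2 λ ())

∣ab-1⇒∤a : ∀ {p} a b → 2 ≤ p → + p ∣ₛ a * b - 1ℤ → ¬ (+ p ∣ₛ a)
∣ab-1⇒∤a {p} a b p≥2 p∣ab-1 p∣a = contradiction (∣ₛ1⇒≡1 p∣1) λ p≡1 → ℕ.<⇒≢ p≥2 (sym p≡1)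
  where
  ba-[ab-1]≡1 : ∀ a b → b * a + -1ℤ * (a * b - 1ℤ) ≡ 1ℤ
  ba-[ab-1]≡1 = solve-∀
  p∣1 : + p ∣ₛ 1ℤ
  p∣1 = ∣ₛ-resp-≡ (ba-[ab-1]≡1 a b) (∣ₛ-linear p∣a p∣ab-1 b -1ℤ)

residues-inverse : ∀ {p} a b u v → + p ∣ₛ a * b - 1ℤ → + p ∣ₛ a + u → + p ∣ₛ b + v → + p ∣ₛ u * v - 1ℤ
residues-inverse a b u v p∣ab-1 p∣a+u p∣b+v =
  ∣ₛ-resp-≡ ([ab-1]+[v[a+u]-a[b+v]]≡uv-1 a b u v) (∣ₛ-linear p∣ab-1 (∣ₛ-linear p∣a+u p∣b+v v (- a)) 1ℤ 1ℤ)
  where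
  [ab-1]+[v[a+u]-a[b+v]]≡uv-1 : ∀ a b u v →
    1ℤ * (a * b - 1ℤ) + 1ℤ * (v * (a + u) + (- a) * (b + v)) ≡ u * v - 1ℤ
  [ab-1]+[v[a+u]-a[b+v]]≡uv-1 = solve-∀

residue-forms-dual : ∀ {p a b f g} → + p ∣ₛ a * b - 1ℤ → ResidueForm p a f → ResidueForm p b g → f ≈P dual g
residue-forms-dual {p} {a} {b} {f} {g} p∣ab-1 (u , u≥1 , u<p , p∣a+u , f≡) (v , v≥1 , v<p , p∣b+v , g≡) =
  via-expansions (inverse-expansions p u v u≥1 u<p v≥1 v<p (residues-inverse a b (+ u) (+ v) p∣ab-1 p∣a+u p∣b+v))
  where
  via-expansions : Σ[ cs ∈ List ℕ ] All (2 ≤_) cs × (cfVec p p u ≡ vec cs) × (cfVec p p v ≡ vec (reverse cs)) →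
                   f ≈P dual g
  via-expansions (cs , cs≥2 , cfVec≡ , cfVecʳ≡) = begin
    norm f                                    ≡⟨ cong norm (trans f≡ (cong proj₁ cfVec≡)) ⟩
    norm (proj₁ (vec cs))                     ≡⟨ mirror ⟩
    norm (dual (proj₁ (vec (reverse cs))))    ≡⟨ cong (norm ∘ dual) (trans g≡ (cong proj₁ cfVecʳ≡)) ⟨
    norm (dual g)                             ∎
    where
    mirror : proj₁ (vec cs) ≈P dual (proj₁ (vec (reverse cs)))
    mirror = vec-reverse-dual cs cs≥2

proposition3p4 : (p : ℕ) (a b : ℤ) → 2 ≤ p → Coprime a (+ p) → Coprime b (+ p)
    → (+ p) ∣ (a * b - 1ℤ) → qS a p ≈P dual (qS b p)
proposition3p4 p a b p≥2 _ _ p∣ab-1ᵤ = from-residues (qS-residue p a p≥2) (qS-residue p b p≥2)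
  where
  p∣ab-1 : + p ∣ₛ a * b - 1ℤ
  p∣ab-1 = Signed.∣ᵤ⇒∣ p∣ab-1ᵤ
  p∣ba-1 : + p ∣ₛ b * a - 1ℤ
  p∣ba-1 = ∣ₛ-resp-≡ (cong (_- 1ℤ) (ℤ.*-comm a b)) p∣ab-1
  from-residues : ∀ {f g} → (+ p ∣ₛ a) ⊎ ResidueForm p a f → (+ p ∣ₛ b) ⊎ ResidueForm p b g → f ≈P dual g
  from-residues (inj₁ p∣a) _          = contradiction p∣a (∣ab-1⇒∤a a b p≥2 p∣ab-1)
  from-residues _          (inj₁ p∣b) = contradiction p∣b (∣ab-1⇒∤a b a p≥2 p∣ba-1)
  from-residues (inj₂ ra)  (inj₂ rb)  = residue-forms-dual {a = a} {b = b} p∣ab-1 ra rb
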